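{- Let $1\le k<n$ and $w=(y_1,\dots,y_{k-r},\overline{z_r},\dots,\overline{z_1},v_1,\dots,v_{n-k})\in W^{OG(k,2n+1)}$. Define $\alpha^{\bf t}_s=n+1-v_s+|\{q:z_q<v_s\}|$ for $1\le s\le n-k$ and $\tilde\alpha^{\bf t}_s=\alpha^{\bf t}_s-(n-k+1-s)$. Then for $1\le i\le k$, the length of the $i$-th column of the Ferrers diagram of $\tilde\alpha^{\bf t}$ (i.e. $|\{s:\tilde\alpha^{\bf t}_s\ge i\}|$) equals $n-k$ if $k+1-i\in\{k-r+1,\dots,k\}$ (i.e. $i\le r$), and equals $|\{l:y_{k+1-i}>v_l\}|$ if $k+1-i\in\{1,\dots,k-r\}$.
   Context: $W^{OG(k,2n+1)}$ is the set of signed permutations in one-line notation $(y_1,\dots,y_{k-r},\overline{z_r},\dots,\overline{z_1},v_1,\dots,v_{n-k})$, $0\le r\le k$, where $\{y_t\}\cup\{z_q\}\cup\{v_l\}=\{1,\dots,n\}$, $y_1<\dots<y_{k-r}$, $z_r>\dots>z_1$, $v_1<\dots<v_{n-k}$, bars denoting negative entries. -}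

module Defs where

open import Data.Nat using (ℕ; zero; suc; _+_; _∸_; _≤_; _<_)
import Data.Nat as ℕ
open import Data.Fin using (Fin; toℕ)
import Data.Fin as Fin
open import Data.Integer using (ℤ; +_; _-_)
import Data.Integer as ℤ
open import Data.List using (List; length; filter)
open import Data.List.Base using (allFin)
open import Data.Product using (Σ; _×_; ∃)
open import Data.Sum using (_⊎_)
open import Relation.Binary.PropositionalEquality using (_≡_)
import Level
open import Relation.Unary using (Pred; Decidable)

count : (m : ℕ) {P : Pred (Fin m) Level.zero} → Decidable P → ℕ
count m P? = length (filter P? (allFin m))

-- An element w = (y_1,…,y_{k-r}, z̄_r,…,z̄_1, v_1,…,v_{n-k}) of W^{OG(k,2n+1)}.
-- Indices are 0-based Fin's: y a = y_{a+1}, z q = z_{q+1}, v l = v_{l+1}.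
record OGElt (n k : ℕ) : Set where
  field
    r    : ℕ
    r≤k  : r ≤ k
    y    : Fin (k ∸ r) → ℕ
    z    : Fin r → ℕ
    v    : Fin (n ∸ k) → ℕ
    y-inc : ∀ a b → a Fin.< b → y a < y b
    z-inc : ∀ a b → a Fin.< b → z a < z b
    v-inc : ∀ a b → a Fin.< b → v a < v b
    y-range : ∀ a → 1 ≤ y a × y a ≤ n
    z-range : ∀ a → 1 ≤ z a × z a ≤ n
    v-range : ∀ a → 1 ≤ v a × v a ≤ n
    cover : ∀ m → 1 ≤ m → m ≤ n →
            (∃ λ a → y a ≡ m) ⊎ (∃ λ a → z a ≡ m) ⊎ (∃ λ a → v a ≡ m)

module _ {n k : ℕ} (w : OGElt n k) where
  open OGElt w

  alpha : Fin (n ∸ k) → ℕ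
  alpha s = (suc n ∸ v s) + count r (λ q → z q ℕ.<? v s)

  -- α̃^t_s = α^t_s - (n-k+1-s), with s = toℕ s' + 1, so n-k+1-s = n-k - toℕ s'
  alphaTilde : Fin (n ∸ k) → ℤ
  alphaTilde s = + alpha s - + ((n ∸ k) ∸ toℕ s)

  colLen : ℕ → ℕ
  colLen i = count (n ∸ k) (λ s → + i ℤ.≤? alphaTilde s)

module Submission where

-- Write w = (y_1,…,y_{k-r}, z̄_r,…,z̄_1, v_1,…,v_{n-k}) and, for an index s
-- of the sequence v, let Y_s = |{a : v_s < y_a}|.
--
-- The entries y, z, v form a list of exactly n numbers covering {1,…,n};
-- hence every value occurs exactly once and exactly n - t entries exceed t.
-- Counting the entries exceeding v_s block by block gives
--     n + 1 - v_s = 1 + Y_s + |{q : v_s < z_q}| + (n-k-s),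
-- and since no z_q equals v_s we have |{q : z_q < v_s}| + |{q : v_s < z_q}| = r.
-- Therefore α_s = r + Y_s + (n-k+1-s), i.e. α̃_s = r + Y_s.  Column i of the
-- Ferrers diagram of α̃ thus has length |{s : i ≤ r + Y_s}|: all n-k rows
-- when i ≤ r, and for i = k+1-t with t ≤ k-r the condition k-r+1-t ≤ Y_s
-- holds, y being increasing, exactly when v_s < y_t.

open import Defs
open import Level using (Level)
open import Data.Nat using (ℕ; zero; suc; _+_; _∸_; _≤_; _<_; z≤n; s≤s; z<s; s≤s⁻¹; _≟_; _<?_; _≤?_)
import Data.Nat as ℕ
open import Data.Nat.Properties
open import Data.Nat.Tactic.RingSolver using (solve-∀)
open import Data.Fin using (Fin; toℕ; zero; suc)
import Data.Fin.Properties as Fin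
open import Data.Integer using (+_; _-_; +≤+)
import Data.Integer as ℤ
import Data.Integer.Properties as ℤ
open import Data.List using (List; []; _∷_; length; filter; map; _++_)
open import Data.List.Base using (allFin)
open import Data.List.Properties
  using (length-map; length-++; length-tabulate; map-tabulate; filter-≐; filter-all; filter-some; filter-++)
open import Data.List.Relation.Unary.All using (universal)
open import Data.List.Membership.Propositional using (_∈_; lose)
open import Data.List.Membership.Propositional.Properties using (∈-map⁺; ∈-++⁺ˡ; ∈-++⁺ʳ; ∈-allFin)
open import Data.Product using (_×_; _,_; proj₁; proj₂)
open import Data.Sum using (_⊎_; inj₁; inj₂; [_,_])
open import Data.Empty using (⊥-elim)
open import Relation.Binary.Definitions using (tri<; tri≈; tri>)
open import Relation.Nullary using (yes; no; ¬_; ¬?; _×-dec_)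
open import Relation.Nullary.Decidable using (toSum)
open import Relation.Unary using (Pred; Decidable; _⊆_; _∪_; _∩_; Empty; Universal)
open import Relation.Unary.Properties using (U?)
open import Relation.Binary.PropositionalEquality
  using (_≡_; _≢_; refl; sym; trans; cong; cong₂; subst; module ≡-Reasoning)

private
  variable
    a ℓ ℓ₁ ℓ₂ : Level
    A B : Set a

countList : {P : Pred A ℓ} → Decidable P → List A → ℕ
countList P? xs = length (filter P? xs)

module _ {P : Pred A ℓ} (P? : Decidable P) where

  count-++ : ∀ xs ys → countList P? (xs ++ ys) ≡ countList P? xs + countList P? ys
  count-++ xs ys = trans (cong length (filter-++ P? xs ys)) (length-++ (filter P? xs))

  count-universal : Universal P → ∀ xs → countList P? xs ≡ length xs
  count-universal all xs = cong length (filter-all P? (universal all xs))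

  count-witness : ∀ {x} xs → x ∈ xs → P x → 1 ≤ countList P? xs
  count-witness xs x∈xs px = filter-some P? (lose x∈xs px)

  count-map : (g : B → A) → ∀ xs → countList (λ b → P? (g b)) xs ≡ countList P? (map g xs)
  count-map g [] = refl
  count-map g (x ∷ xs) with P? (g x)
  ... | yes _ = cong suc (count-map g xs)
  ... | no _  = count-map g xs

module _ {P : Pred A ℓ₁} {Q : Pred A ℓ₂} (P? : Decidable P) (Q? : Decidable Q) where

  count-mono : P ⊆ Q → ∀ xs → countList P? xs ≤ countList Q? xs
  count-mono P⊆Q [] = z≤n
  count-mono P⊆Q (x ∷ xs) with P? x | Q? x
  ... | yes _ | yes _  = s≤s (count-mono P⊆Q xs)
  ... | yes p | no ¬q  = ⊥-elim (¬q (P⊆Q p))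
  ... | no _  | yes _  = m≤n⇒m≤1+n (count-mono P⊆Q xs)
  ... | no _  | no _   = count-mono P⊆Q xs

  count-≐ : P ⊆ Q → Q ⊆ P → ∀ xs → countList P? xs ≡ countList Q? xs
  count-≐ P⊆Q Q⊆P xs = cong length (filter-≐ P? Q? (P⊆Q , Q⊆P) xs)

count-disjoint-∪ : {P : Pred A ℓ} {Q R : Pred A ℓ₁} →
  (P? : Decidable P) (Q? : Decidable Q) (R? : Decidable R) →
  P ⊆ Q ∪ R → Q ⊆ P → R ⊆ P → Empty (Q ∩ R) →
  ∀ xs → countList P? xs ≡ countList Q? xs + countList R? xs
count-disjoint-∪ P? Q? R? split Q⊆P R⊆P disjoint [] = refl
count-disjoint-∪ P? Q? R? split Q⊆P R⊆P disjoint (x ∷ xs) with P? x | Q? x | R? x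
... | yes _ | yes q | yes r = ⊥-elim (disjoint x (q , r))
... | yes _ | yes _ | no _  = cong suc (count-disjoint-∪ P? Q? R? split Q⊆P R⊆P disjoint xs)
... | yes _ | no _  | yes _ =
  trans (cong suc (count-disjoint-∪ P? Q? R? split Q⊆P R⊆P disjoint xs)) (sym (+-suc _ _))
... | yes p | no ¬q | no ¬r = ⊥-elim ([ ¬q , ¬r ] (split p))
... | no ¬p | yes q | _     = ⊥-elim (¬p (Q⊆P q))
... | no ¬p | no _  | yes r = ⊥-elim (¬p (R⊆P r))
... | no _  | no _  | no _  = count-disjoint-∪ P? Q? R? split Q⊆P R⊆P disjoint xs

count-dichotomy : {Q R : Pred A ℓ} (Q? : Decidable Q) (R? : Decidable R) →
  (∀ x → Q x ⊎ R x) → Empty (Q ∩ R) → ∀ xs → countList Q? xs + countList R? xs ≡ length xs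
count-dichotomy Q? R? total disjoint xs = begin
  countList Q? xs + countList R? xs
    ≡⟨ count-disjoint-∪ U? Q? R? (λ {x} _ → total x) _ _ disjoint xs ⟨
  countList U? xs
    ≡⟨ count-universal U? _ xs ⟩
  length xs ∎
  where open ≡-Reasoning

count-complement : {P : Pred A ℓ} (P? : Decidable P) →
  ∀ xs → countList P? xs + countList (λ x → ¬? (P? x)) xs ≡ length xs
count-complement P? = count-dichotomy P? (λ x → ¬? (P? x)) (λ x → toSum (P? x)) (λ x (p , ¬p) → ¬p p)

length-allFin : ∀ m → length (allFin m) ≡ m
length-allFin m = length-tabulate (λ a → a)

length-map-allFin : ∀ {m} (f : Fin m → A) → length (map f (allFin m)) ≡ m
length-map-allFin {m = m} f = trans (length-map f (allFin m)) (length-allFin m)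

allFin-suc : ∀ m → allFin (suc m) ≡ zero ∷ map suc (allFin m)
allFin-suc m = cong (zero ∷_) (sym (map-tabulate (λ a → a) suc))

count-Fin-≥ : ∀ m x → count m (λ a → x ≤? toℕ a) ≡ m ∸ x
count-Fin-≥ m zero = trans (count-universal (λ a → 0 ≤? toℕ a) (λ _ → z≤n) (allFin m)) (length-allFin m)
count-Fin-≥ zero (suc x) = refl
count-Fin-≥ (suc m) (suc x) = begin
  countList (λ a → suc x ≤? toℕ a) (allFin (suc m))
    ≡⟨ cong (countList (λ a → suc x ≤? toℕ a)) (allFin-suc m) ⟩
  countList (λ a → suc x ≤? toℕ a) (map suc (allFin m))
    ≡⟨ count-map (λ a → suc x ≤? toℕ a) suc (allFin m) ⟨
  countList (λ a → suc x ≤? suc (toℕ a)) (allFin m)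
    ≡⟨ count-≐ _ (λ a → x ≤? toℕ a) s≤s⁻¹ s≤s (allFin m) ⟩
  count m (λ a → x ≤? toℕ a)
    ≡⟨ count-Fin-≥ m x ⟩
  m ∸ x ∎
  where open ≡-Reasoning

module Increasing {m : ℕ} (f : Fin m → ℕ) (increasing : ∀ a b → toℕ a < toℕ b → f a < f b) where

  monotone : ∀ a b → toℕ a ≤ toℕ b → f a ≤ f b
  monotone a b a≤b with m≤n⇒m<n∨m≡n a≤b
  ... | inj₁ a<b = <⇒≤ (increasing a b a<b)
  ... | inj₂ a≡b = ≤-reflexive (cong f (Fin.toℕ-injective a≡b))

  below-later : ∀ c a b → c < f a → ¬ (c < f b) → toℕ b < toℕ a
  below-later c a b c<fa c≮fb = ≰⇒> (λ a≤b → c≮fb (<-≤-trans c<fa (monotone a b a≤b)))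

  count-above-entry : ∀ t → count m (λ a → f t <? f a) ≡ m ∸ suc (toℕ t)
  count-above-entry t = trans
    (count-≐ _ (λ a → suc (toℕ t) ≤? toℕ a)
             (λ {a} ft<fa → below-later (f t) a t ft<fa (<-irrefl refl))
             (λ {a} t<a → increasing t a t<a) (allFin m))
    (count-Fin-≥ m (suc (toℕ t)))

  threshold⇒ : ∀ c t → c < f t → m ∸ toℕ t ≤ count m (λ a → c <? f a)
  threshold⇒ c t c<ft = subst (_≤ count m (λ a → c <? f a)) (count-Fin-≥ m (toℕ t))
    (count-mono (λ a → toℕ t ≤? toℕ a) (λ a → c <? f a)
                (λ {a} t≤a → <-≤-trans c<ft (monotone t a t≤a)) (allFin m))

  threshold⇐ : ∀ c t → m ∸ toℕ t ≤ count m (λ a → c <? f a) → c < f t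
  threshold⇐ c t many with c <? f t
  ... | yes c<ft = c<ft
  ... | no c≮ft = ⊥-elim (<⇒≱ (∸-monoʳ-< (n<1+n (toℕ t)) (Fin.toℕ<n t)) (≤-trans many few))
    where
    few : count m (λ a → c <? f a) ≤ m ∸ suc (toℕ t)
    few = subst (count m (λ a → c <? f a) ≤_) (count-Fin-≥ m (suc (toℕ t)))
      (count-mono (λ a → c <? f a) (λ a → suc (toℕ t) ≤? toℕ a)
                  (λ {a} c<fa → below-later c a t c<fa c≮ft) (allFin m))

window? : (a b : ℕ) → Decidable (λ x → a < x × x ≤ b)
window? a b x = (a <? x) ×-dec (x ≤? b)

window-split : ∀ a d xs →
  countList (window? a (a + suc d)) xs ≡ countList (window? a (a + d)) xs + countList (_≟ a + suc d) xs
window-split a d = count-disjoint-∪ (window? a (a + suc d)) (window? a (a + d)) (_≟ a + suc d)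
  last-or-rest
  (λ (a<x , x≤a+d) → a<x , ≤-trans x≤a+d (<⇒≤ a+d<a+1+d))
  (λ { refl → m<m+n a z<s , ≤-refl })
  (λ x ((_ , x≤a+d) , x≡) → <⇒≱ a+d<a+1+d (subst (_≤ a + d) x≡ x≤a+d))
  where
  a+d<a+1+d : a + d < a + suc d
  a+d<a+1+d = +-monoʳ-< a (n<1+n d)
  last-or-rest : ∀ {x} → a < x × x ≤ a + suc d → (a < x × x ≤ a + d) ⊎ x ≡ a + suc d
  last-or-rest (a<x , x≤) with m≤n⇒m<n∨m≡n x≤
  ... | inj₁ x<  = inj₁ (a<x , s≤s⁻¹ (≤-trans x< (≤-reflexive (+-suc a d))))
  ... | inj₂ x≡  = inj₂ x≡

-- A list of exactly n naturals containing every value 1,…,n, i.e. a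
-- permutation of 1,…,n.  Its counting properties used below follow from a
-- lower bound for every window together with the total length n.
module Covering (L : List ℕ) (n : ℕ) (length≡n : length L ≡ n)
                (covers : ∀ m → 1 ≤ m → m ≤ n → m ∈ L) where

  window-count : ∀ a d → (∀ m → a < m → m ≤ a + d → m ∈ L) → d ≤ countList (window? a (a + d)) L
  window-count a zero _ = z≤n
  window-count a (suc d) contains = begin
    suc d                                                          ≡⟨ +-comm 1 d ⟩
    d + 1                                                          ≤⟨ +-mono-≤ earlier last ⟩
    countList (window? a (a + d)) L + countList (_≟ a + suc d) L   ≡⟨ window-split a d L ⟨
    countList (window? a (a + suc d)) L                            ∎
    where
    open ≤-Reasoning
    earlier : d ≤ countList (window? a (a + d)) L
    earlier = window-count a d (λ m a<m m≤a+d → contains m a<m (≤-trans m≤a+d (+-monoʳ-≤ a (n≤1+n d))))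
    last : 1 ≤ countList (_≟ a + suc d) L
    last = count-witness (_≟ a + suc d) L (contains (a + suc d) (m<m+n a z<s) ≤-refl) refl

  -- Exactly n - t entries exceed t: at least n - t lie in (t, n], at least t
  -- lie in (0, t], and there are n entries in total.
  count-above : ∀ t → t ≤ n → countList (t <?_) L ≡ n ∸ t
  count-above t t≤n = ≤-antisym at-most at-least
    where
    at-least : n ∸ t ≤ countList (t <?_) L
    at-least = ≤-trans
      (window-count t (n ∸ t) (λ m t<m m≤ →
         covers m (≤-trans (s≤s z≤n) t<m) (subst (m ≤_) (m+[n∸m]≡n t≤n) m≤)))
      (count-mono (window? t (t + (n ∸ t))) (t <?_) proj₁ L)
    at-least-rest : t ≤ countList (λ x → ¬? (t <? x)) L
    at-least-rest = ≤-trans (window-count 0 t (λ m 0<m m≤t → covers m 0<m (≤-trans m≤t t≤n)))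
                            (count-mono (window? 0 t) (λ x → ¬? (t <? x)) (λ (_ , x≤t) → ≤⇒≯ x≤t) L)
    at-most : countList (t <?_) L ≤ n ∸ t
    at-most = m+n≤o⇒m≤o∸n (countList (t <?_) L)
      (≤-trans (+-monoʳ-≤ (countList (t <?_) L) at-least-rest)
               (≤-reflexive (trans (count-complement (t <?_) L) length≡n)))

  -- Every value 1,…,n occurs exactly once: the entries above m - 1 are the
  -- occurrences of m together with the entries above m.
  occurs-once : ∀ m → 1 ≤ m → m ≤ n → countList (_≟ m) L ≡ 1
  occurs-once (suc m) _ 1+m≤n =
    +-cancelʳ-≡ (n ∸ suc m) _ 1 (trans (sym split) (+-∸-assoc 1 1+m≤n))
    where
    equal-or-above : ∀ {x} → m < x → x ≡ suc m ⊎ suc m < x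
    equal-or-above m<x with m≤n⇒m<n∨m≡n m<x
    ... | inj₁ 1+m<x = inj₂ 1+m<x
    ... | inj₂ 1+m≡x = inj₁ (sym 1+m≡x)
    split : n ∸ m ≡ countList (_≟ suc m) L + (n ∸ suc m)
    split = begin
      n ∸ m                                                    ≡⟨ count-above m (<⇒≤ 1+m≤n) ⟨
      countList (m <?_) L
        ≡⟨ count-disjoint-∪ (m <?_) (_≟ suc m) (suc m <?_) equal-or-above
             (λ { refl → ≤-refl }) <⇒≤ (λ x (x≡ , 1+m<x) → <-irrefl (sym x≡) 1+m<x) L ⟩
      countList (_≟ suc m) L + countList (suc m <?_) L
        ≡⟨ cong (λ u → countList (_≟ suc m) L + u) (count-above (suc m) 1+m≤n) ⟩
      countList (_≟ suc m) L + (n ∸ suc m)                     ∎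
      where open ≡-Reasoning

+[m+n]-n≡m : ∀ m n → + (m + n) - + n ≡ + m
+[m+n]-n≡m m n = begin
  + (m + n) - + n      ≡⟨ ℤ.m-n≡m⊖n (m + n) n ⟩
  (m + n) ℤ.⊖ n        ≡⟨ ℤ.⊖-≥ (m≤n+m n m) ⟩
  + (m + n ∸ n)        ≡⟨ cong +_ (m+n∸n≡m m n) ⟩
  + m                  ∎
  where open ≡-Reasoning

module OG {n k : ℕ} (k≤n : k ≤ n) (w : OGElt n k) where
  open OGElt w

  ys zs vs entries : List ℕ
  ys = map y (allFin (k ∸ r))
  zs = map z (allFin r)
  vs = map v (allFin (n ∸ k))
  entries = ys ++ (zs ++ vs)

  entries-length : length entries ≡ n
  entries-length = begin
    length entries                           ≡⟨ length-++ ys ⟩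
    length ys + length (zs ++ vs)            ≡⟨ cong (λ u → length ys + u) (length-++ zs) ⟩
    length ys + (length zs + length vs)      ≡⟨ cong₂ (λ a b → a + (b + length vs))
                                                      (length-map-allFin y) (length-map-allFin z) ⟩
    (k ∸ r) + (r + length vs)                ≡⟨ cong (λ u → (k ∸ r) + (r + u)) (length-map-allFin v) ⟩
    (k ∸ r) + (r + (n ∸ k))                  ≡⟨ +-assoc (k ∸ r) r (n ∸ k) ⟨
    (k ∸ r) + r + (n ∸ k)                    ≡⟨ cong (_+ (n ∸ k)) (m∸n+n≡m r≤k) ⟩
    k + (n ∸ k)                              ≡⟨ m+[n∸m]≡n k≤n ⟩
    n                                        ∎
    where open ≡-Reasoning

  entries-cover : ∀ m → 1 ≤ m → m ≤ n → m ∈ entries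
  entries-cover m 1≤m m≤n with cover m 1≤m m≤n
  ... | inj₁ (a , refl)        = ∈-++⁺ˡ (∈-map⁺ y (∈-allFin a))
  ... | inj₂ (inj₁ (a , refl)) = ∈-++⁺ʳ ys (∈-++⁺ˡ (∈-map⁺ z (∈-allFin a)))
  ... | inj₂ (inj₂ (a , refl)) = ∈-++⁺ʳ ys (∈-++⁺ʳ zs (∈-map⁺ v (∈-allFin a)))

  open Covering entries n entries-length entries-cover

  count-entries : {P : Pred ℕ ℓ} (P? : Decidable P) →
    countList P? entries ≡ countList P? ys + (countList P? zs + countList P? vs)
  count-entries P? = trans (count-++ P? ys (zs ++ vs)) (cong (λ u → countList P? ys + u) (count-++ P? zs vs))

  -- No z_q equals any v_s, since every value occurs only once among the entries.
  z≢v : ∀ q s → z q ≢ v s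
  z≢v q s zq≡vs = <⇒≱ (s≤s (s≤s z≤n)) (begin
    2
      ≤⟨ +-mono-≤ (count-witness (_≟ v s) zs (∈-map⁺ z (∈-allFin q)) zq≡vs)
                  (count-witness (_≟ v s) vs (∈-map⁺ v (∈-allFin s)) refl) ⟩
    countList (_≟ v s) zs + countList (_≟ v s) vs ≤⟨ m≤n+m _ (countList (_≟ v s) ys) ⟩
    countList (_≟ v s) ys + (countList (_≟ v s) zs + countList (_≟ v s) vs) ≡⟨ count-entries (_≟ v s) ⟨
    countList (_≟ v s) entries                  ≡⟨ occurs-once (v s) (proj₁ (v-range s)) (proj₂ (v-range s)) ⟩
    1                                           ∎)
    where open ≤-Reasoning

  Y Z< Z> : Fin (n ∸ k) → ℕ
  Y s  = count (k ∸ r) (λ a → v s <? y a)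
  Z< s = count r (λ q → z q <? v s)
  Z> s = count r (λ q → v s <? z q)

  Z<+Z>≡r : ∀ s → Z< s + Z> s ≡ r
  Z<+Z>≡r s = trans (count-dichotomy (λ q → z q <? v s) (λ q → v s <? z q) below-or-above
                                     (λ q (zq<vs , vs<zq) → <-asym zq<vs vs<zq) (allFin r))
                    (length-allFin r)
    where
    below-or-above : ∀ q → z q < v s ⊎ v s < z q
    below-or-above q with <-cmp (z q) (v s)
    ... | tri< zq<vs _ _ = inj₁ zq<vs
    ... | tri≈ _ zq≡vs _ = ⊥-elim (z≢v q s zq≡vs)
    ... | tri> _ _ vs<zq = inj₂ vs<zq

  -- Counting the entries above v_s block by block.
  entries-above-v : ∀ s → n ∸ v s ≡ Y s + (Z> s + ((n ∸ k) ∸ suc (toℕ s)))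
  entries-above-v s = begin
    n ∸ v s                         ≡⟨ count-above (v s) (proj₂ (v-range s)) ⟨
    countList (v s <?_) entries     ≡⟨ count-entries (v s <?_) ⟩
    countList (v s <?_) ys + (countList (v s <?_) zs + countList (v s <?_) vs)
      ≡⟨ cong₂ (λ a b → a + (b + countList (v s <?_) vs))
               (count-map (v s <?_) y (allFin (k ∸ r))) (count-map (v s <?_) z (allFin r)) ⟨
    Y s + (Z> s + countList (v s <?_) vs)
      ≡⟨ cong (λ u → Y s + (Z> s + u)) (count-map (v s <?_) v (allFin (n ∸ k))) ⟨
    Y s + (Z> s + count (n ∸ k) (λ l → v s <? v l))
      ≡⟨ cong (λ u → Y s + (Z> s + u)) (Increasing.count-above-entry v v-inc s) ⟩
    Y s + (Z> s + ((n ∸ k) ∸ suc (toℕ s))) ∎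
    where open ≡-Reasoning

  alpha≡ : ∀ s → alpha w s ≡ (r + Y s) + ((n ∸ k) ∸ toℕ s)
  alpha≡ s = begin
    (suc n ∸ v s) + Z< s
      ≡⟨ cong (_+ Z< s) (+-∸-assoc 1 (proj₂ (v-range s))) ⟩
    suc (n ∸ v s) + Z< s                                       ≡⟨ cong (λ u → suc u + Z< s) (entries-above-v s) ⟩
    suc (Y s + (Z> s + V)) + Z< s                              ≡⟨ regroup (Y s) (Z< s) (Z> s) V ⟩
    (Z< s + Z> s + Y s) + suc V                                ≡⟨ cong₂ (λ a b → a + Y s + b) (Z<+Z>≡r s)
                                                                        (sym (+-∸-assoc 1 (Fin.toℕ<n s))) ⟩
    (r + Y s) + ((n ∸ k) ∸ toℕ s)                              ∎
    where
    open ≡-Reasoning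
    V = (n ∸ k) ∸ suc (toℕ s)
    regroup : ∀ a z< z> d → suc (a + (z> + d)) + z< ≡ (z< + z> + a) + suc d
    regroup = solve-∀

  alphaTilde≡ : ∀ s → alphaTilde w s ≡ + (r + Y s)
  alphaTilde≡ s = trans (cong (λ u → + u - + ((n ∸ k) ∸ toℕ s)) (alpha≡ s))
                        (+[m+n]-n≡m (r + Y s) ((n ∸ k) ∸ toℕ s))

  colLen≡ : ∀ i → colLen w i ≡ count (n ∸ k) (λ s → i ≤? r + Y s)
  colLen≡ i = count-≐ (λ s → + i ℤ.≤? alphaTilde w s) (λ s → i ≤? r + Y s)
    (λ {s} i≤α̃ → ℤ.drop‿+≤+ (subst (+ i ℤ.≤_) (alphaTilde≡ s) i≤α̃))
    (λ {s} i≤r+Y → subst (+ i ℤ.≤_) (sym (alphaTilde≡ s)) (+≤+ i≤r+Y)) (allFin (n ∸ k))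

  colLen-full : ∀ i → i ≤ r → colLen w i ≡ n ∸ k
  colLen-full i i≤r = trans (colLen≡ i)
    (trans (count-universal (λ s → i ≤? r + Y s) (λ s → ≤-trans i≤r (m≤m+n r (Y s))) (allFin (n ∸ k)))
           (length-allFin (n ∸ k)))

  -- Column k - j (0 ≤ j < k - r; in the paper's 1-based indexing column k+1-t
  -- with t = j+1 ≤ k-r) counts the v_l lying below y_j: since y is increasing,
  -- k - j ≤ r + Y_l, i.e. (k-r) - j ≤ Y_l, holds exactly when v_l < y_j.
  colLen-y : (j : Fin (k ∸ r)) → colLen w (k ∸ toℕ j) ≡ count (n ∸ k) (λ l → v l <? y j)
  colLen-y j = trans (colLen≡ (k ∸ toℕ j)) (count-≐ _ _ below-yj at-least (allFin (n ∸ k)))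
    where
    k-j≡ : k ∸ toℕ j ≡ r + ((k ∸ r) ∸ toℕ j)
    k-j≡ = trans (cong (_∸ toℕ j) (sym (m+[n∸m]≡n r≤k))) (+-∸-assoc r (<⇒≤ (Fin.toℕ<n j)))
    below-yj : ∀ {l} → k ∸ toℕ j ≤ r + Y l → v l < y j
    below-yj {l} bound = Increasing.threshold⇐ y y-inc (v l) j (+-cancelˡ-≤ r _ _ (subst (_≤ r + Y l) k-j≡ bound))
    at-least : ∀ {l} → v l < y j → k ∸ toℕ j ≤ r + Y l
    at-least {l} vl<yj = subst (_≤ r + Y l) (sym k-j≡) (+-monoʳ-≤ r (Increasing.threshold⇒ y y-inc (v l) j vl<yj))

claim3p2 : (n k : ℕ) → 1 ≤ k → k < n → (w : OGElt n k) →
    ((i : ℕ) → 1 ≤ i → i ≤ OGElt.r w → colLen w i ≡ n ∸ k)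
    × ((j : Fin (k ∸ OGElt.r w)) →
         colLen w (k ∸ toℕ j) ≡ count (n ∸ k) (λ l → OGElt.v w l ℕ.<? OGElt.y w j))
claim3p2 n k _ k<n w = (λ i _ → colLen-full i) , colLen-y
  where open OG (<⇒≤ k<n) w
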